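{- Let $G=(V,E)$ be a connected finite simple graph with $n=|V|$, and let $\mathcal G$ be the graph constructed from $G$ as described in the context. Let $\mathcal S$ be a proper stalled subset of the vertex set of $\mathcal G$ such that $|\mathcal S|\geqslant (2n+1)|E|+2$ and $\varepsilon\in\mathcal S$. Then $\mathcal S\cap V$ is a union of (zero or more) connected components of $G$, i.e. no edge of $G$ joins a vertex of $\mathcal S\cap V$ to a vertex of $V\setminus\mathcal S$.
   Context: For a finite simple graph $H$ with vertex set $W$ and a set $F\subseteq W$: a vertex $v\in W\setminus F$ is forced by $F$ if there is $u\in F$ such that $v$ is the unique neighbor of $u$ outside $F$. $F$ is stalled if no vertex of $W\setminus F$ is forced by $F$; $F$ is proper if $F\neq W$. Construction of $\mathcal G$: given $G=(V,E)$ with $n=|V|$, let $E^i=\{e^i : e\in E\}$ for $i=0,1,\dots,2n$ be $2n+1$ pairwise disjoint copies of $E$ (disjoint from $V$), and let $\varepsilon$ be a further new vertex. The vertex set of $\mathcal G$ is $\mathcal V=V\cup E^0\cup\dots\cup E^{2n}\cup\{\varepsilon\}$. The edges of $\mathcal G$ are exactly: for every edge $e=\{u,v\}\in E$, the edges $\{u,e^0\}$ and $\{e^0,v\}$; the edges $\{e^i,e^{i+1}\}$ for $0\le i\le 2n-1$; and the edge $\{\varepsilon,e^0\}$. -}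

module Defs where

open import Data.Nat using (ℕ; zero; suc; _+_; _*_; _≥_)
open import Data.Fin using (Fin; toℕ)
open import Data.Empty using (⊥)
open import Data.Product using (Σ; ∃; _×_; _,_; proj₁; proj₂)
open import Data.Sum using (_⊎_)
open import Data.Bool using (Bool; true; false)
open import Data.List using (List; []; _∷_; _++_; map; concatMap; filter; length; allFin)
open import Relation.Binary.PropositionalEquality using (_≡_; _≢_)
open import Relation.Nullary using (¬_)
open import Data.Bool.Properties using () renaming (_≟_ to _≟B_)

record SimpleGraph (n : ℕ) : Set where
  field
    m        : ℕ
    ends     : Fin m → Fin n × Fin n
    loopless : ∀ e → proj₁ (ends e) ≢ proj₂ (ends e)
    noMulti  : ∀ e f →
               (ends e ≡ ends f ⊎ (proj₁ (ends e) ≡ proj₂ (ends f) × proj₂ (ends e) ≡ proj₁ (ends f)))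
               → e ≡ f

open SimpleGraph public

IsEnd : ∀ {n} (G : SimpleGraph n) → Fin n → Fin (m G) → Set
IsEnd G u e = u ≡ proj₁ (ends G e) ⊎ u ≡ proj₂ (ends G e)

Adj : ∀ {n} (G : SimpleGraph n) → Fin n → Fin n → Set
Adj G u v = ∃ λ e → ends G e ≡ (u , v) ⊎ ends G e ≡ (v , u)

data Walk {n} (G : SimpleGraph n) : Fin n → Fin n → Set where
  here : ∀ {u} → Walk G u u
  step : ∀ {u v w} → Adj G u v → Walk G v w → Walk G u w

Connected : ∀ {n} → SimpleGraph n → Set
Connected {n} G = ∀ (u v : Fin n) → Walk G u v

-- The graph 𝒢 built from G.
-- Vertices: V ⊎ (E^0 ⊎ … ⊎ E^{2n}) ⊎ {ε}.

data 𝒱 (n m : ℕ) : Set where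
  vtx : Fin n → 𝒱 n m
  edg : Fin (suc (2 * n)) → Fin m → 𝒱 n m
  eps : 𝒱 n m

𝒜 : ∀ {n} (G : SimpleGraph n) → 𝒱 n (m G) → 𝒱 n (m G) → Set
𝒜 G (vtx u)   (vtx v)   = ⊥
𝒜 G (vtx u)   (edg i e) = toℕ i ≡ 0 × IsEnd G u e
𝒜 G (vtx u)   eps       = ⊥
𝒜 G (edg i e) (vtx u)   = toℕ i ≡ 0 × IsEnd G u e
𝒜 G (edg i e) (edg j f) = e ≡ f × (toℕ j ≡ suc (toℕ i) ⊎ toℕ i ≡ suc (toℕ j))
𝒜 G (edg i e) eps       = toℕ i ≡ 0
𝒜 G eps       (vtx u)   = ⊥
𝒜 G eps       (edg i e) = toℕ i ≡ 0
𝒜 G eps       eps       = ⊥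

all𝒱 : (n m : ℕ) → List (𝒱 n m)
all𝒱 n m = map vtx (allFin n)
        ++ concatMap (λ i → map (edg i) (allFin m)) (allFin (suc (2 * n)))
        ++ (eps ∷ [])

Subset𝒱 : ℕ → ℕ → Set
Subset𝒱 n m = 𝒱 n m → Bool

_∈_ : ∀ {n m} → 𝒱 n m → Subset𝒱 n m → Set
x ∈ F = F x ≡ true

_∉_ : ∀ {n m} → 𝒱 n m → Subset𝒱 n m → Set
x ∉ F = F x ≡ false

card : ∀ {n m} → Subset𝒱 n m → ℕ
card {n} {m} F = length (filter (λ x → F x ≟B true) (all𝒱 n m))

Forced : ∀ {n} (G : SimpleGraph n) → Subset𝒱 n (m G) → 𝒱 n (m G) → Set
Forced G F v = v ∉ F × ∃ λ u → u ∈ F × 𝒜 G u v ×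
               (∀ w → 𝒜 G u w → w ∉ F → w ≡ v)

Stalled : ∀ {n} (G : SimpleGraph n) → Subset𝒱 n (m G) → Set
Stalled G F = ∀ v → v ∉ F → ¬ Forced G F v

Proper : ∀ {n m} → Subset𝒱 n m → Set
Proper F = ¬ (∀ x → x ∈ F)

-- Suppose an edge e = {a, b} of G had a ∈ S and b ∉ S. Then no two consecutive vertices
-- of the pendant path e⁰ e¹ … e²ⁿ of 𝒢 lie in S: if e⁰ and e¹ did, e⁰ would force b
-- (its neighbours are a, b, ε and e¹), and if eⁱ⁺¹ and eⁱ⁺² did, then either eⁱ ∈ S as
-- well or eⁱ⁺¹ would force eⁱ. So at least n of the 2n + 1 path vertices are missing
-- from S, whence |S| ≤ |𝒱| − n = (2n + 1)|E| + 1, contradicting the size hypothesis.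
module Submission where

open import Defs
open import Data.Nat using (ℕ; suc; _+_; _*_; _≥_)
open import Data.Fin using (Fin)
open import Data.Product using (_×_; proj₁; proj₂)
open import Relation.Nullary using (¬_)
open import Data.Sum using (_⊎_)

open import Level using (Level)
open import Data.Nat using (zero; _≤_; _<_; z≤n; s≤s; s≤s⁻¹)
open import Data.Nat.Properties
open import Data.Fin using (toℕ; inject₁) renaming (zero to fzero; suc to fsuc)
open import Data.Fin.Properties using (toℕ-injective; toℕ-inject₁)
open import Data.Product using (_,_)
open import Data.Sum using (inj₁; inj₂; swap)
open import Data.Bool using (true; false)
open import Data.Bool.Properties using () renaming (_≟_ to _≟B_)
open import Data.Empty using (⊥-elim)
open import Data.List using (List; []; _∷_; _++_; map; concatMap; filter; length; allFin; tabulate)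
open import Data.List.Properties using (length-++; length-map; length-tabulate; map-tabulate)
open import Data.List.Membership.Propositional.Properties using (∈-allFin; ∈-map⁺)
open import Data.List.Relation.Binary.Sublist.Propositional using (_⊆_; []; from∈)
open import Data.List.Relation.Binary.Sublist.Propositional.Properties
  using (++⁺; ++⁺ˡ; ++⁺ʳ; filter⁺; length-mono-≤)
open import Function using (id; _∘_)
open import Relation.Nullary using (Dec; yes; no; does)
open import Relation.Unary using (Pred; Decidable)
open import Relation.Unary.Properties using (∁?)
open import Relation.Binary.PropositionalEquality

private variable
  ℓ ℓ′ : Level
  A B : Set ℓ

NoTwoConsecutive : ∀ {k} → Pred (Fin k) ℓ → Set ℓ
NoTwoConsecutive P = ∀ i j → toℕ j ≡ suc (toℕ i) → P i → ¬ P j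

module _ {P : Pred A ℓ′} (P? : Decidable P) where

  length-filter+length-filter-∁ : ∀ xs →
    length (filter P? xs) + length (filter (∁? P?) xs) ≡ length xs
  length-filter+length-filter-∁ [] = refl
  length-filter+length-filter-∁ (x ∷ xs) with does (P? x)
  ... | true  = cong suc (length-filter+length-filter-∁ xs)
  ... | false = trans (+-suc _ _) (cong suc (length-filter+length-filter-∁ xs))

  length-filter-∁-pair : ∀ {x y} xs → ¬ (P x × P y) →
    suc (length (filter (∁? P?) xs)) ≤ length (filter (∁? P?) (x ∷ y ∷ xs))
  length-filter-∁-pair {x} {y} xs ¬Px×Py with P? x
  ... | no _ with P? y
  ...   | yes _ = ≤-refl
  ...   | no _  = n≤1+n _
  length-filter-∁-pair {x} {y} xs ¬Px×Py | yes Px with P? y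
  ...   | yes Py = ⊥-elim (¬Px×Py (Px , Py))
  ...   | no _   = ≤-refl

  noTwoConsecutive⇒length≤2*count∁ : ∀ {k} (f : Fin k → A) → NoTwoConsecutive (P ∘ f) →
    k ≤ suc (2 * length (filter (∁? P?) (tabulate f)))
  noTwoConsecutive⇒length≤2*count∁ {zero} f _ = z≤n
  noTwoConsecutive⇒length≤2*count∁ {suc zero} f _ = s≤s z≤n
  noTwoConsecutive⇒length≤2*count∁ {suc (suc k)} f noTwo = begin
    suc (suc k)              ≤⟨ s≤s (s≤s ih) ⟩
    suc (2 + 2 * c)          ≡⟨ cong suc (sym (*-suc 2 c)) ⟩
    suc (2 * suc c)          ≤⟨ s≤s (*-monoʳ-≤ 2 (length-filter-∁-pair rest first-pair)) ⟩
    suc (2 * length (filter (∁? P?) (f fzero ∷ f (fsuc fzero) ∷ rest))) ∎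
    where
    open ≤-Reasoning
    rest : List A
    rest = tabulate (f ∘ fsuc ∘ fsuc)
    c : ℕ
    c = length (filter (∁? P?) rest)
    ih : k ≤ suc (2 * c)
    ih = noTwoConsecutive⇒length≤2*count∁ (f ∘ fsuc ∘ fsuc)
           (λ i j j≡1+i → noTwo (fsuc (fsuc i)) (fsuc (fsuc j)) (cong (suc ∘ suc) j≡1+i))
    first-pair : ¬ (P (f fzero) × P (f (fsuc fzero)))
    first-pair (P₀ , P₁) = noTwo fzero (fsuc fzero) refl P₀ P₁

length-concatMap-const : ∀ {c} (f : A → List B) → (∀ x → length (f x) ≡ c) →
  ∀ xs → length (concatMap f xs) ≡ length xs * c
length-concatMap-const f _ [] = refl
length-concatMap-const f length-f≡c (x ∷ xs) =
  trans (length-++ (f x)) (cong₂ _+_ (length-f≡c x) (length-concatMap-const f length-f≡c xs))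

_∈?_ : ∀ {n m} (x : 𝒱 n m) (F : Subset𝒱 n m) → Dec (x ∈ F)
x ∈? F = F x ≟B true

∈-∉-disjoint : ∀ {n m} (F : Subset𝒱 n m) {x} → x ∈ F → ¬ x ∉ F
∈-∉-disjoint _ x∈F x∉F with trans (sym x∈F) x∉F
... | ()

length-all𝒱 : ∀ n m → length (all𝒱 n m) ≡ n + (suc (2 * n) * m + 1)
length-all𝒱 n m = begin
  length (all𝒱 n m)
    ≡⟨ length-++ (map vtx (allFin n)) ⟩
  length (map vtx (allFin n)) + length (layers ++ eps ∷ [])
    ≡⟨ cong₂ _+_ (trans (length-map vtx (allFin n)) (length-tabulate {n = n} id)) (length-++ layers) ⟩
  n + (length layers + 1)
    ≡⟨ cong (λ l → n + (l + 1)) (length-concatMap-const copy length-copy (allFin (suc (2 * n)))) ⟩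
  n + (length (allFin (suc (2 * n))) * m + 1)
    ≡⟨ cong (λ l → n + (l * m + 1)) (length-tabulate {n = suc (2 * n)} id) ⟩
  n + (suc (2 * n) * m + 1)
    ∎
  where
  open ≡-Reasoning
  copy : Fin (suc (2 * n)) → List (𝒱 n m)
  copy i = map (edg i) (allFin m)
  length-copy : ∀ i → length (copy i) ≡ m
  length-copy i = trans (length-map (edg i) (allFin m)) (length-tabulate {n = m} id)
  layers : List (𝒱 n m)
  layers = concatMap copy (allFin (suc (2 * n)))

path : ∀ {n m} → Fin m → List (𝒱 n m)
path e = tabulate (λ i → edg i e)

path⊆all𝒱 : ∀ {n m} (e : Fin m) → path {n} e ⊆ all𝒱 n m
path⊆all𝒱 {n} {m} e =
  subst (_⊆ all𝒱 n m) (map-tabulate id (λ i → edg i e))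
    (++⁺ˡ (map vtx (allFin n)) (++⁺ʳ (eps ∷ []) (copies⊆layers (allFin (suc (2 * n))))))
  where
  copies⊆layers : ∀ (is : List (Fin (suc (2 * n)))) →
    map (λ i → edg {n} i e) is ⊆ concatMap (λ i → map (edg i) (allFin m)) is
  copies⊆layers []       = []
  copies⊆layers (i ∷ is) = ++⁺ (from∈ (∈-map⁺ (edg i) (∈-allFin e))) (copies⊆layers is)

module CrossingEdge {n} (G : SimpleGraph n) (S : Subset𝒱 n (m G))
  (stalled : Stalled G S) (eps∈S : eps ∈ S)
  {e : Fin (m G)} {a b : Fin n} (a∈S : vtx a ∈ S) (b∉S : vtx b ∉ S)
  (b-end : IsEnd G b e) (ends⊆ab : ∀ x → IsEnd G x e → x ≡ a ⊎ x ≡ b) where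

  same-level : ∀ {j k : Fin (suc (2 * n))} → toℕ j ≡ toℕ k → edg j e ∈ S → ¬ edg k e ∉ S
  same-level j≡k eʲ∈S = ∈-∉-disjoint S (subst (λ l → edg l e ∈ S) (toℕ-injective j≡k) eʲ∈S)

  b-forced-by-e⁰ : ∀ {i j} → toℕ i ≡ 0 → toℕ j ≡ 1 →
    edg i e ∈ S → edg j e ∈ S → Forced G S (vtx b)
  b-forced-by-e⁰ {i} {j} i≡0 j≡1 eⁱ∈S eʲ∈S = b∉S , edg i e , eⁱ∈S , (i≡0 , b-end) , only-b
    where
    only-b : ∀ w → 𝒜 G (edg i e) w → w ∉ S → w ≡ vtx b
    only-b (vtx x) (_ , x-end) x∉S with ends⊆ab x x-end
    ... | inj₁ refl = ⊥-elim (∈-∉-disjoint S a∈S x∉S)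
    ... | inj₂ refl = refl
    only-b (edg k _) (refl , inj₁ k≡1+i) eᵏ∉S =
      ⊥-elim (same-level (trans j≡1 (sym (trans k≡1+i (cong suc i≡0)))) eʲ∈S eᵏ∉S)
    only-b (edg k _) (refl , inj₂ i≡1+k) _ = ⊥-elim (0≢1+n (trans (sym i≡0) i≡1+k))
    only-b eps _ eps∉S = ⊥-elim (∈-∉-disjoint S eps∈S eps∉S)

  lower-forced : ∀ {i j k} → toℕ j ≡ suc (toℕ i) → toℕ k ≡ suc (toℕ j) →
    edg i e ∉ S → edg j e ∈ S → edg k e ∈ S → Forced G S (edg i e)
  lower-forced {i} {j} {k} j≡1+i k≡1+j eⁱ∉S eʲ∈S eᵏ∈S =
    eⁱ∉S , edg j e , eʲ∈S , (refl , inj₂ j≡1+i) , only-eⁱ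
    where
    only-eⁱ : ∀ w → 𝒜 G (edg j e) w → w ∉ S → w ≡ edg i e
    only-eⁱ (vtx _) (j≡0 , _) _ = ⊥-elim (1+n≢0 (trans (sym j≡1+i) j≡0))
    only-eⁱ (edg l _) (refl , inj₁ l≡1+j) eˡ∉S =
      ⊥-elim (same-level (trans k≡1+j (sym l≡1+j)) eᵏ∈S eˡ∉S)
    only-eⁱ (edg l _) (refl , inj₂ j≡1+l) _ =
      cong (λ l → edg l e) (toℕ-injective (suc-injective (trans (sym j≡1+l) j≡1+i)))
    only-eⁱ eps j≡0 _ = ⊥-elim (1+n≢0 (trans (sym j≡1+i) j≡0))

  path-noTwoConsecutive : NoTwoConsecutive (λ i → edg i e ∈ S)
  path-noTwoConsecutive i j j≡1+i = descend (toℕ i) refl j≡1+i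
    where
    descend : ∀ t {i j} → toℕ i ≡ t → toℕ j ≡ suc t → edg i e ∈ S → ¬ edg j e ∈ S
    descend zero i≡0 j≡1 eⁱ∈S eʲ∈S = stalled (vtx b) b∉S (b-forced-by-e⁰ i≡0 j≡1 eⁱ∈S eʲ∈S)
    descend (suc t) {fsuc i} {j} i≡1+t j≡2+t eⁱ∈S eʲ∈S with S (edg (inject₁ i) e) in below
    ... | true  = descend t (trans (toℕ-inject₁ i) (suc-injective i≡1+t)) i≡1+t below eⁱ∈S
    ... | false = stalled _ below
      (lower-forced (cong suc (sym (toℕ-inject₁ i))) (trans j≡2+t (cong suc (sym i≡1+t)))
         below eⁱ∈S eʲ∈S)

  n≤count∉-path : n ≤ length (filter (∁? (_∈? S)) (path e))
  n≤count∉-path = *-cancelˡ-≤ 2 (s≤s⁻¹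
    (noTwoConsecutive⇒length≤2*count∁ (_∈? S) (λ i → edg i e) path-noTwoConsecutive))

  card≤ : card S ≤ suc (2 * n) * m G + 1
  card≤ = +-cancelˡ-≤ n _ _ (begin
    n + card S                  ≡⟨ +-comm n (card S) ⟩
    card S + n                  ≤⟨ +-monoʳ-≤ (card S) n≤count∉ ⟩
    card S + count∉             ≡⟨ length-filter+length-filter-∁ (_∈? S) (all𝒱 n (m G)) ⟩
    length (all𝒱 n (m G))       ≡⟨ length-all𝒱 n (m G) ⟩
    n + (suc (2 * n) * m G + 1) ∎)
    where
    open ≤-Reasoning
    count∉ : ℕ
    count∉ = length (filter (∁? (_∈? S)) (all𝒱 n (m G)))
    n≤count∉ : n ≤ count∉
    n≤count∉ = ≤-trans n≤count∉-path
      (length-mono-≤ (filter⁺ (∁? (_∈? S)) (∁? (_∈? S)) (λ { refl → id }) (path⊆all𝒱 e)))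

  card< : card S < suc (2 * n) * m G + 2
  card< = ≤-trans (s≤s card≤) (≤-reflexive (sym (+-suc (suc (2 * n) * m G) 1)))

mainTheorem6 : ∀ {n : ℕ} (G : SimpleGraph n) → Connected G →
    (S : Subset𝒱 n (m G)) → Proper S → Stalled G S →
    card S ≥ suc (2 * n) * m G + 2 → eps ∈ S →
    ∀ (e : Fin (m G)) →
      ¬ ((vtx (proj₁ (ends G e)) ∈ S × vtx (proj₂ (ends G e)) ∉ S)
        ⊎ (vtx (proj₂ (ends G e)) ∈ S × vtx (proj₁ (ends G e)) ∉ S))
mainTheorem6 G _ S _ stalled large eps∈S e (inj₁ (a∈S , b∉S)) =
  <⇒≱ (CrossingEdge.card< G S stalled eps∈S a∈S b∉S (inj₂ refl) (λ _ → id)) large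
mainTheorem6 G _ S _ stalled large eps∈S e (inj₂ (b∈S , a∉S)) =
  <⇒≱ (CrossingEdge.card< G S stalled eps∈S b∈S a∉S (inj₁ refl) (λ _ → swap)) large
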